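{- Let $p$ be a prime and $r$ a nonzero integer. If $j$ is an integer coprime to $p$, then $$\xi_{p^{\lambda} r}(pm - j) \equiv 0 \pmod{p^{\lambda}}$$ for all positive integers $m$ and $\lambda$.
   Context: For an integer $r$, the $r$-Fishburn numbers $\xi_r(n)$, $n \ge 0$, are defined by the identity of formal power series in $q$ $$\sum_{n\geq 0} \xi_r(n) q^n = \sum_{n \geq 0} \prod_{i=1}^n \bigl(1 - (1-q)^{ri}\bigr),$$ where $(1-q)^k$ for negative $k$ is the usual power series expansion; the sum is well defined since the $n$-th summand is divisible by $q^n$. By convention $\xi_r(n) = 0$ for $n < 0$. -}

module Defs where

open import Data.Nat as ℕ using (ℕ; zero; suc)
open import Data.Nat.Combinatorics using (_C_)
open import Data.Integer as ℤ using (ℤ; +_; -[1+_]; 0ℤ; 1ℤ)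

Series : Set
Series = ℕ → ℤ

-- Coefficients of (1-q)^k for an integer k:
--   k = n ≥ 0 : coefficient of q^m is (-1)^m * C(n,m)
--   k = -(s+1): coefficient of q^m is C(s+m, m)
binomSeries : ℤ → Series
binomSeries (+ n) m = (ℤ.- 1ℤ) ℤ.^ m ℤ.* + (n C m)
binomSeries -[1+ s ] m = + ((s ℕ.+ m) C m)

sumTo : ℕ → (ℕ → ℤ) → ℤ
sumTo zero f = f 0
sumTo (suc n) f = sumTo n f ℤ.+ f (suc n)

_⊛_ : Series → Series → Series
(f ⊛ g) n = sumTo n (λ i → f i ℤ.* g (n ℕ.∸ i))

oneS : Series
oneS zero = 1ℤ
oneS (suc _) = 0ℤ

factor : ℤ → Series
factor k m = oneS m ℤ.- binomSeries k m

prodFactors : ℤ → ℕ → Series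
prodFactors r zero = oneS
prodFactors r (suc n) = prodFactors r n ⊛ factor (r ℤ.* + suc n)

-- ξ_r(n) for n ≥ 0: coefficient of q^n in Σ_{k≥0} ∏_{i=1}^k (1-(1-q)^{ri});
-- only k ≤ n contribute since the k-th summand is divisible by q^k.
fishburnℕ : ℤ → ℕ → ℤ
fishburnℕ r n = sumTo n (λ k → prodFactors r k n)

fishburn : ℤ → ℤ → ℤ
fishburn r (+ n) = fishburnℕ r n
fishburn r -[1+ _ ] = 0ℤ

module Submission where

-- Write D f for the series with coefficients n · f(n) (that is,
-- q · f′).  Call f "d-derivative-divisible" if d divides every coefficient of
-- D f.  This class contains 1, is closed under Cauchy products (Leibniz rule
-- D(fg) = (Df)g + f(Dg)) and under finite sums, and it contains every factor
-- 1 - (1-q)^k with d ∣ k, because D (1-q)^k = -k q (1-q)^(k-1); on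
-- coefficients this is the binomial absorption identity.  Hence, if d ∣ R,
-- then d ∣ n · ξ_R(n) for every n.
--
-- Apply this with d = p^λ and R = p^λ r.  For n = pm - j ≥ 0 we have
-- gcd(p, n) = gcd(p, j) = 1, so p^λ ∣ n · ξ(n) forces p^λ ∣ ξ(n); for
-- pm - j < 0 the value ξ is 0 by convention.  (Primality of p is only used
-- to know p ≠ 0; the argument needs just gcd(p, j) = 1.)

open import Defs
open import Data.Nat as ℕ using (ℕ; _≤_)
open import Data.Nat.Primality using (Prime)
open import Data.Nat.Coprimality using (Coprime)
open import Data.Integer as ℤ using (ℤ; +_; 0ℤ; ∣_∣)
open import Data.Integer.Divisibility using (_∣_)
open import Relation.Binary.PropositionalEquality using (_≢_)

open import Data.Nat using (zero; suc; _+_; _*_; _∸_; z≤n; s≤s; NonZero)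
import Data.Nat.Properties as ℕP
open import Data.Nat.Combinatorics
  using (_C_; nCk+nC[k+1]≡[n+1]C[k+1]; nCk≡nC[n∸k]; nCn≡1; nC1≡n; k>n⇒nCk≡0)
import Data.Nat.Divisibility as ℕD
open import Data.Nat.Divisibility using (divides)
open import Data.Nat.Coprimality using (coprime-divisor)
open import Data.Nat.Primality using (prime⇒nonZero)
import Data.Nat.Tactic.RingSolver as ℕRing
import Data.Integer.Properties as ℤP
import Data.Integer.Divisibility.Signed as ℤD
open import Data.Integer.Divisibility.Signed using () renaming (_∣_ to _∣ₛ_)
import Data.Integer.Tactic.RingSolver as ℤRing
open import Data.Product using (_,_)
open import Relation.Binary.PropositionalEquality
  using (_≡_; refl; sym; trans; cong; cong₂; subst; subst₂; module ≡-Reasoning)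

open ≡-Reasoning

nC0≡1 : ∀ n → n C 0 ≡ 1
nC0≡1 n = trans (nCk≡nC[n∸k] {n = n} z≤n) (nCn≡1 n)

absorption : ∀ n k → suc k * (suc n C suc k) ≡ suc n * (n C k)
absorption n zero = begin
  1 * (suc n C 1)  ≡⟨ ℕP.*-identityˡ _ ⟩
  suc n C 1        ≡⟨ nC1≡n (suc n) ⟩
  suc n            ≡⟨ ℕP.*-identityʳ (suc n) ⟨
  suc n * 1        ≡⟨ cong (suc n *_) (nC0≡1 n) ⟨
  suc n * (n C 0)  ∎
absorption zero (suc k) = begin
  suc (suc k) * (1 C suc (suc k))  ≡⟨ cong (suc (suc k) *_) (k>n⇒nCk≡0 {1} {suc (suc k)} (s≤s (s≤s z≤n))) ⟩
  suc (suc k) * 0                  ≡⟨ ℕP.*-zeroʳ (suc (suc k)) ⟩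
  0                                ≡⟨ cong (1 *_) (k>n⇒nCk≡0 {0} {suc k} (s≤s z≤n)) ⟨
  1 * (0 C suc k)                  ∎
absorption (suc n) (suc k) = begin
  suc (suc k) * (suc (suc n) C suc (suc k))
    ≡⟨ cong (suc (suc k) *_) (nCk+nC[k+1]≡[n+1]C[k+1] (suc n) (suc k)) ⟨
  suc (suc k) * (a + b)
    ≡⟨ distribute k a b ⟩
  a + suc k * a + suc (suc k) * b
    ≡⟨ cong₂ (λ x y → a + x + y) (absorption n k) (absorption n (suc k)) ⟩
  a + suc n * (n C k) + suc n * (n C suc k)
    ≡⟨ collect a (suc n) (n C k) (n C suc k) ⟩
  a + suc n * (n C k + n C suc k)
    ≡⟨ cong (λ x → a + suc n * x) (nCk+nC[k+1]≡[n+1]C[k+1] n k) ⟩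
  suc (suc n) * a ∎
  where
  a = suc n C suc k
  b = suc n C suc (suc k)
  distribute : ∀ k a b → suc (suc k) * (a + b) ≡ a + suc k * a + suc (suc k) * b
  distribute = ℕRing.solve-∀
  collect : ∀ a m x y → a + m * x + m * y ≡ a + m * (x + y)
  collect = ℕRing.solve-∀

-- It follows from absorption
-- for N = s+k+1 and Pascal's rule after cancelling (k+1) · C(N, k).
absorption-neg : ∀ s k → suc k * ((s + suc k) C suc k) ≡ suc s * ((s + suc k) C k)
absorption-neg s k = ℕP.+-cancelˡ-≡ (suc k * x) _ _ (begin
  suc k * x + suc k * y  ≡⟨ ℕP.*-distribˡ-+ (suc k) x y ⟨
  suc k * (x + y)        ≡⟨ cong (suc k *_) (nCk+nC[k+1]≡[n+1]C[k+1] N k) ⟩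
  suc k * (suc N C suc k) ≡⟨ absorption N k ⟩
  suc N * x              ≡⟨ split s k x ⟩
  suc k * x + suc s * x  ∎)
  where
  N = s + suc k
  x = N C k
  y = N C suc k
  split : ∀ s k x → suc (s + suc k) * x ≡ suc k * x + suc s * x
  split = ℕRing.solve-∀

absorption-∣ : ∀ N n → N ℕD.∣ n * (N C n)
absorption-∣ N zero = N ℕD.∣0
absorption-∣ zero (suc n) =
  subst (0 ℕD.∣_) (sym (trans (cong (suc n *_) (k>n⇒nCk≡0 {0} {suc n} (s≤s z≤n)))
                              (ℕP.*-zeroʳ (suc n))))
        (0 ℕD.∣0)
absorption-∣ (suc N) (suc n) = subst (suc N ℕD.∣_) (sym (absorption N n)) (ℕD.m∣m*n (N C n))

absorption-neg-∣ : ∀ s n → suc s ℕD.∣ n * ((s + n) C n)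
absorption-neg-∣ s zero = suc s ℕD.∣0
absorption-neg-∣ s (suc n) =
  subst (suc s ℕD.∣_) (sym (absorption-neg s n)) (ℕD.m∣m*n ((s + suc n) C n))

∣ₛ0 : ∀ d → d ∣ₛ 0ℤ
∣ₛ0 d = ℤD.∣ᵤ⇒∣ (∣ d ∣ ℕD.∣0)

∣ᵤ-product⇒∣ₛ : ∀ {k : ℤ} a b → ∣ k ∣ ℕD.∣ a * b → k ∣ₛ + a ℤ.* + b
∣ᵤ-product⇒∣ₛ {k} a b h = ℤD.∣ᵤ⇒∣ (subst (∣ k ∣ ℕD.∣_) (sym (ℤP.abs-* (+ a) (+ b))) h)

-- The derivative of (1-q)^k is -k (1-q)^(k-1), so k divides n times the
-- n-th coefficient of (1-q)^k, for every integer exponent k.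
binomSeries-derivative : ∀ k n → k ∣ₛ + n ℤ.* binomSeries k n
binomSeries-derivative (+ N) n =
  subst (+ N ∣ₛ_) (swap (+ n) ((ℤ.- ℤ.1ℤ) ℤ.^ n) (+ (N C n)))
        (ℤD.∣n⇒∣m*n ((ℤ.- ℤ.1ℤ) ℤ.^ n) (∣ᵤ-product⇒∣ₛ n (N C n) (absorption-∣ N n)))
  where
  swap : ∀ a b c → b ℤ.* (a ℤ.* c) ≡ a ℤ.* (b ℤ.* c)
  swap = ℤRing.solve-∀
binomSeries-derivative ℤ.-[1+ s ] n = ∣ᵤ-product⇒∣ₛ n ((s + n) C n) (absorption-neg-∣ s n)

DerivDivisible : ℤ → Series → Set
DerivDivisible d f = ∀ n → d ∣ₛ + n ℤ.* f n

module _ {d : ℤ} where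

  ∣-scaled-sumTo : ∀ c k f → (∀ i → i ≤ k → d ∣ₛ c ℤ.* f i) → d ∣ₛ c ℤ.* sumTo k f
  ∣-scaled-sumTo c zero f h = h 0 z≤n
  ∣-scaled-sumTo c (suc k) f h =
    subst (d ∣ₛ_) (sym (ℤP.*-distribˡ-+ c (sumTo k f) (f (suc k))))
      (ℤD.∣m∣n⇒∣m+n (∣-scaled-sumTo c k f (λ i i≤k → h i (ℕP.m≤n⇒m≤1+n i≤k)))
                    (h (suc k) ℕP.≤-refl))

  oneS-derivDivisible : DerivDivisible d oneS
  oneS-derivDivisible zero = ∣ₛ0 d
  oneS-derivDivisible (suc n) = subst (d ∣ₛ_) (sym (ℤP.*-zeroʳ (+ suc n))) (∣ₛ0 d)

  leibniz-term : ∀ n i (x y : ℤ) → i ≤ n →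
                 + n ℤ.* (x ℤ.* y) ≡ (+ i ℤ.* x) ℤ.* y ℤ.+ x ℤ.* (+ (n ∸ i) ℤ.* y)
  leibniz-term n i x y i≤n = begin
    + n ℤ.* (x ℤ.* y)                     ≡⟨ cong (λ z → + z ℤ.* (x ℤ.* y)) (ℕP.m+[n∸m]≡n i≤n) ⟨
    + (i + (n ∸ i)) ℤ.* (x ℤ.* y)         ≡⟨ cong (ℤ._* (x ℤ.* y)) (ℤP.pos-+ i (n ∸ i)) ⟩
    (+ i ℤ.+ + (n ∸ i)) ℤ.* (x ℤ.* y)     ≡⟨ expand (+ i) (+ (n ∸ i)) x y ⟩
    (+ i ℤ.* x) ℤ.* y ℤ.+ x ℤ.* (+ (n ∸ i) ℤ.* y) ∎
    where
    expand : ∀ a b x y → (a ℤ.+ b) ℤ.* (x ℤ.* y) ≡ (a ℤ.* x) ℤ.* y ℤ.+ x ℤ.* (b ℤ.* y)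
    expand = ℤRing.solve-∀

  ⊛-derivDivisible : ∀ {f g} → DerivDivisible d f → DerivDivisible d g →
                     DerivDivisible d (f ⊛ g)
  ⊛-derivDivisible {f} {g} df dg n = ∣-scaled-sumTo (+ n) n _ λ i i≤n →
    subst (d ∣ₛ_) (sym (leibniz-term n i (f i) (g (n ∸ i)) i≤n))
      (ℤD.∣m∣n⇒∣m+n (ℤD.∣m⇒∣m*n (g (n ∸ i)) (df i))
                    (ℤD.∣n⇒∣m*n (f i) (dg (n ∸ i))))

  factor-derivDivisible : ∀ k → d ∣ₛ k → DerivDivisible d (factor k)
  factor-derivDivisible k d∣k n =
    subst (d ∣ₛ_) (sym (distribute (+ n) (oneS n) (binomSeries k n)))
      (ℤD.∣m∣n⇒∣m-n (oneS-derivDivisible n) (ℤD.∣-trans d∣k (binomSeries-derivative k n)))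
    where
    distribute : ∀ a x y → a ℤ.* (x ℤ.- y) ≡ a ℤ.* x ℤ.- a ℤ.* y
    distribute = ℤRing.solve-∀

  prodFactors-derivDivisible : ∀ R → d ∣ₛ R → ∀ k → DerivDivisible d (prodFactors R k)
  prodFactors-derivDivisible R d∣R zero = oneS-derivDivisible
  prodFactors-derivDivisible R d∣R (suc k) =
    ⊛-derivDivisible (prodFactors-derivDivisible R d∣R k)
                     (factor-derivDivisible (R ℤ.* + suc k) (ℤD.∣m⇒∣m*n (+ suc k) d∣R))

  fishburn-derivDivisible : ∀ R → d ∣ₛ R → DerivDivisible d (fishburnℕ R)
  fishburn-derivDivisible R d∣R n =
    ∣-scaled-sumTo (+ n) n _ (λ k _ → prodFactors-derivDivisible R d∣R k n)

-- If p is coprime to n, every power of p dividing n · X divides X: peel off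
-- one factor p at a time, using that p ∣ n · X forces p ∣ X.
coprime-pow-divisor : ∀ {p n} .{{_ : NonZero p}} → Coprime p n →
                      ∀ k {X} → p ℕ.^ k ℕD.∣ n * X → p ℕ.^ k ℕD.∣ X
coprime-pow-divisor p⊥n zero {X} _ = ℕD.1∣ X
coprime-pow-divisor {p} {n} p⊥n (suc k) h
  with coprime-divisor p⊥n (ℕD.∣-trans (ℕD.m∣m*n (p ℕ.^ k)) h)
... | divides Y refl =
  subst (p ℕ.^ suc k ℕD.∣_) (ℕP.*-comm p Y)
    (ℕD.*-monoʳ-∣ p (coprime-pow-divisor p⊥n k
      (ℕD.*-cancelˡ-∣ p (subst (p ℕ.^ suc k ℕD.∣_) (rearrange n Y p) h))))
  where
  rearrange : ∀ n Y p → n * (Y * p) ≡ p * (n * Y)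
  rearrange = ℕRing.solve-∀

-- If a is coprime to j then a is coprime to a·m - j: a common divisor of a
-- and a·m - j also divides j = a·m - (a·m - j).
coprime-sub : ∀ a (m j : ℤ) → Coprime a ∣ j ∣ → Coprime a ∣ + a ℤ.* m ℤ.- j ∣
coprime-sub a m j a⊥j {d} (d∣a , d∣n) = a⊥j (d∣a , ℤD.∣⇒∣ᵤ d∣j)
  where
  d∣j : + d ∣ₛ j
  d∣j = subst (+ d ∣ₛ_) (recover (+ a ℤ.* m) j)
          (ℤD.∣m∣n⇒∣m-n (ℤD.∣m⇒∣m*n m (ℤD.∣ᵤ⇒∣ {+ d} {+ a} d∣a))
                        (ℤD.∣ᵤ⇒∣ {+ d} {+ a ℤ.* m ℤ.- j} d∣n))
    where
    recover : ∀ x j → x ℤ.- (x ℤ.- j) ≡ j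
    recover = ℤRing.solve-∀

abs-pow : ∀ p k → ∣ (+ p) ℤ.^ k ∣ ≡ p ℕ.^ k
abs-pow p zero = refl
abs-pow p (suc k) = trans (ℤP.abs-* (+ p) ((+ p) ℤ.^ k)) (cong (p *_) (abs-pow p k))

pow-cancel : ∀ {p n} .{{_ : NonZero p}} → Coprime p n →
             ∀ k F → (+ p) ℤ.^ k ∣ₛ + n ℤ.* F → (+ p) ℤ.^ k ∣ F
pow-cancel {p} {n} p⊥n k F h =
  subst (ℕD._∣ ∣ F ∣) (sym (abs-pow p k))
    (coprime-pow-divisor p⊥n k
      (subst₂ ℕD._∣_ (abs-pow p k) (ℤP.abs-* (+ n) F) (ℤD.∣⇒∣ᵤ h)))

lemma1 : (p : ℕ) → Prime p → (r : ℤ) → r ≢ 0ℤ → (j : ℤ) → Coprime p ∣ j ∣ →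
         (m lam : ℕ) → 1 ≤ m → 1 ≤ lam →
         ((+ p) ℤ.^ lam) ∣ fishburn ((+ p) ℤ.^ lam ℤ.* r) ((+ p) ℤ.* (+ m) ℤ.- j)
lemma1 p p-prime r _ j p⊥j m lam _ _ with (+ p) ℤ.* (+ m) ℤ.- j in eq
... | ℤ.-[1+ _ ] = ∣ (+ p) ℤ.^ lam ∣ ℕD.∣0
... | + n = pow-cancel {{prime⇒nonZero p-prime}} p⊥n lam (fishburnℕ R n) p^λ∣nξ
  where
  R = (+ p) ℤ.^ lam ℤ.* r
  p^λ∣nξ : (+ p) ℤ.^ lam ∣ₛ + n ℤ.* fishburnℕ R n
  p^λ∣nξ = fishburn-derivDivisible R (ℤD.∣m⇒∣m*n r ℤD.∣-refl) n
  p⊥n : Coprime p n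
  p⊥n = subst (Coprime p) (cong ∣_∣ eq) (coprime-sub p (+ m) j p⊥j)
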